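{- For any integers $a,b,u\ge 0$ with $a+b\le u$, there exists a family $\mathbb S$ of subsets of $\{1,2,\dots,u\}$ with $\lg|\mathbb S|=O\left(\lg\lg u+\lg\binom{a+b}{a}\right)$ such that for all $A,B\subseteq\{1,2,\dots,u\}$ with $|A|\le a$, $|B|\le b$ and $A\cap B=\emptyset$, there exists $S\in\mathbb S$ with $A\subseteq S$ and $B\subseteq\overline S$ (the complement of $S$ in $\{1,\dots,u\}$).
   Context: $\lg x$ denotes $\log_2(2+x)$. -}

module Defs where

open import Data.Nat using (ℕ; _+_)
open import Data.Nat.Logarithm using (⌈log₂_⌉)

-- lg x = log₂(2 + x), rounded up to a natural number.
-- (Ceiling changes lg by a factor in [1,2) since lg x ≥ 1, so O(·)-statements are unaffected.)
lg : ℕ → ℕ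
lg x = ⌈log₂ (2 + x) ⌉

{-# OPTIONS --safe #-}

-- Probabilistic method, derandomised greedily. Let n = a + b and let a random S contain each point
-- independently with probability a / n. A disjoint pair (A, B) with ∣A∣ ≤ a and ∣B∣ ≤ b is then separated
-- by S with probability at least q = a ^ a b ^ b / n ^ n, and q ≥ 1 / ((n + 1) C(n, a)) because
-- C(n, a) a ^ a b ^ b is the largest of the n + 1 terms of the binomial expansion of (a + b) ^ n.
-- Hence among any such pairs some S separates a fraction at least q; choosing such an S round after
-- round leaves at most (1 - q) ^ k of the fewer than 2 ^ (n lg u) pairs after k rounds, and none once
-- k = (n + 1) C(n, a) n lg u. As n ≤ C(n, a) when a, b ≥ 1, lg k ≤ 4 (lg lg u + lg C(n, a)). For a = 0
-- or b = 0 the single set ∅ or {1, …, u} suffices.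

module Submission where

open import Defs
open import Data.Bool using (Bool; true; false; not; _∧_; T)
open import Data.Empty using (⊥-elim)
open import Data.Fin using (zero)
open import Data.Fin.Subset using (Subset; Side; inside; outside; ⊥; ⊤; _⊆_; ∁; ∣_∣; _∩_; Empty)
open import Data.Fin.Subset.Properties using (drop-∷-Empty; x∈p⇒∣p-x∣<∣p∣; x∉p⇒x∈∁p; ∉⊥; ∈⊤)
open import Data.List using (List; []; _∷_; [_]; length; map; _++_; filterᵇ)
open import Data.List.Membership.Propositional using (_∈_)
open import Data.List.Membership.Propositional.Properties using (∈-map⁺; ∈-++⁺ˡ; ∈-++⁺ʳ; ∈-filter⁺)
open import Data.List.Properties using (length-map; length-++)
open import Data.List.Relation.Unary.All as All using (All; []; _∷_)
import Data.List.Relation.Unary.All.Properties as All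
open import Data.List.Relation.Unary.Any using (here; there)
open import Data.Nat
  using (ℕ; zero; suc; _+_; _*_; _∸_; _^_; _≤_; _<_; _≤′_; ≤′-refl; ≤′-step; ⌊_/2⌋; ⌈_/2⌉; z≤n; s≤s;
         NonZero; >-nonZero; >-nonZero⁻¹)
open import Data.Nat.Combinatorics using (_C_; nCk+nC[k+1]≡[n+1]C[k+1]; nC1≡n)
open import Data.Nat.Combinatorics.Specification using (k>n⇒nCk≡0)
open import Data.Nat.Induction using (<-wellFounded)
open import Data.Nat.ListAction using (sum)
open import Data.Nat.Logarithm using (⌈log₂_⌉; ⌈log₂⌉-mono-≤; ⌈log₂2^n⌉≡n)
open import Data.Nat.Logarithm.Core using (⌈log2⌉)
open import Data.Nat.Properties
open import Algebra.Properties.CommutativeSemigroup *-commutativeSemigroup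
  using (x∙yz≈xz∙y; xy∙z≈xz∙y; x∙yz≈y∙xz; interchange)
open import Data.Nat.Solver using (module +-*-Solver)
open +-*-Solver using (solve; _:=_; _:+_; _:*_; con)
open import Data.Product using (Σ; ∃; _×_; _,_; proj₁; proj₂)
open import Data.Sum using (inj₁; inj₂)
open import Data.Vec using ([]; _∷_; here; there)
open import Function using (_∘_)
open import Induction.WellFounded using (Acc; acc)
open import Relation.Binary.PropositionalEquality
  using (_≡_; refl; sym; trans; cong; cong₂; subst; module ≡-Reasoning)
open import Relation.Nullary using (yes; no)
open import Relation.Nullary.Decidable using (T?)

unimodal-max : (f : ℕ → ℕ) (p : ℕ) →
               (∀ {k} → k < p → f k ≤ f (suc k)) → (∀ {k} → p ≤ k → f (suc k) ≤ f k) →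
               ∀ k → f k ≤ f p
unimodal-max f p rising falling k with k ≤? p
... | yes k≤p = ascend (≤⇒≤′ k≤p) ≤-refl
  where
    ascend : ∀ {m} → k ≤′ m → m ≤ p → f k ≤ f m
    ascend ≤′-refl         _   = ≤-refl
    ascend (≤′-step k≤′m) m≤p = ≤-trans (ascend k≤′m (<⇒≤ m≤p)) (rising m≤p)
... | no k≰p = descend (≤⇒≤′ (≰⇒≥ k≰p))
  where
    descend : ∀ {m} → p ≤′ m → f m ≤ f p
    descend ≤′-refl         = ≤-refl
    descend (≤′-step p≤′m) = ≤-trans (falling (≤′⇒≤ p≤′m)) (descend p≤′m)

bernoulli : ∀ t x y → x ^ suc t + suc t * y * x ^ t ≤ (x + y) ^ suc t
bernoulli zero x y = ≤-reflexive
  (solve 2 (λ x y → x :* con 1 :+ (y :+ con 0 :* y) :* con 1 := (x :+ y) :* con 1) refl x y)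
bernoulli (suc t) x y = begin
  x ^ suc (suc t) + suc (suc t) * y * x ^ suc t
    ≤⟨ m≤m+n _ (suc t * y * (y * x ^ t)) ⟩
  x ^ suc (suc t) + suc (suc t) * y * x ^ suc t + suc t * y * (y * x ^ t)
    ≡⟨ solve 4 (λ x y t p → x :* (x :* p) :+ (con 2 :+ t) :* y :* (x :* p) :+ (con 1 :+ t) :* y :* (y :* p)
                          := (x :+ y) :* (x :* p :+ (con 1 :+ t) :* y :* p)) refl x y t (x ^ t) ⟩
  (x + y) * (x ^ suc t + suc t * y * x ^ t)
    ≤⟨ *-monoʳ-≤ (x + y) (bernoulli t x y) ⟩
  (x + y) ^ suc (suc t) ∎
  where open ≤-Reasoning

halving : ∀ t .{{_ : NonZero t}} {N D} → N ≤ D → D ≤ t * N → 2 * (D ∸ N) ^ t ≤ D ^ t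
halving (suc t) {N} {D} N≤D D≤tN = begin
  2 * E ^ suc t                  ≡⟨ cong (E ^ suc t +_) (+-identityʳ (E ^ suc t)) ⟩
  E ^ suc t + E * E ^ t          ≤⟨ +-monoʳ-≤ (E ^ suc t) (*-monoˡ-≤ (E ^ t) (≤-trans (m∸n≤m D N) D≤tN)) ⟩
  E ^ suc t + suc t * N * E ^ t  ≤⟨ bernoulli t E N ⟩
  (E + N) ^ suc t                ≡⟨ cong (_^ suc t) (m∸n+n≡m N≤D) ⟩
  D ^ suc t                      ∎
  where
    open ≤-Reasoning
    E : ℕ
    E = D ∸ N

m<n∧n*o≤p∧0<p⇒m*o<p : ∀ {m n o p} → m < n → n * o ≤ p → 0 < p → m * o < p
m<n∧n*o≤p∧0<p⇒m*o<p {m} {o = zero} {p} _ _ 0<p = subst (_< p) (sym (*-zeroʳ m)) 0<p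
m<n∧n*o≤p∧0<p⇒m*o<p {o = suc _} m<n n*o≤p _   = <-≤-trans (*-monoˡ-< _ m<n) n*o≤p

*-≤⇒^-*-≤ : ∀ {x y z} r → x * y ≤ z → x ^ r * y ^ r ≤ z ^ r
*-≤⇒^-*-≤ zero    _      = ≤-refl
*-≤⇒^-*-≤ {x} {y} {z} (suc r) xy≤z = begin
  x * x ^ r * (y * y ^ r)    ≡⟨ interchange x (x ^ r) y (y ^ r) ⟩
  x * y * (x ^ r * y ^ r)    ≤⟨ *-mono-≤ xy≤z (*-≤⇒^-*-≤ r xy≤z) ⟩
  z * z ^ r                  ∎
  where open ≤-Reasoning

^*^≤[+]^[+] : ∀ a b α β → a ^ α * b ^ β ≤ (a + b) ^ (α + β)
^*^≤[+]^[+] a b α β = begin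
  a ^ α * b ^ β              ≤⟨ *-mono-≤ (^-monoˡ-≤ α (m≤m+n a b)) (^-monoˡ-≤ β (m≤n+m b a)) ⟩
  (a + b) ^ α * (a + b) ^ β  ≡⟨ sym (^-distribˡ-+-* (a + b) α β) ⟩
  (a + b) ^ (α + β)          ∎
  where open ≤-Reasoning

n≤2^⌈log₂n⌉ : ∀ n → n ≤ 2 ^ ⌈log₂ n ⌉
n≤2^⌈log₂n⌉ n = go n (<-wellFounded n)
  where
    go : ∀ m (rec : Acc _<_ m) → m ≤ 2 ^ ⌈log2⌉ m rec
    go zero          _         = z≤n
    go (suc zero)    _         = s≤s z≤n
    go (suc (suc m)) (acc rs) = begin
      suc (suc m)                     ≡⟨ cong (λ z → suc (suc z)) (sym (⌊n/2⌋+⌈n/2⌉≡n m)) ⟩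
      suc (suc (⌊ m /2⌋ + ⌈ m /2⌉))   ≤⟨ s≤s (s≤s (+-monoˡ-≤ ⌈ m /2⌉ (⌊n/2⌋≤⌈n/2⌉ m))) ⟩
      suc (suc (⌈ m /2⌉ + ⌈ m /2⌉))   ≡⟨ cong suc (sym (+-suc ⌈ m /2⌉ ⌈ m /2⌉)) ⟩
      suc ⌈ m /2⌉ + suc ⌈ m /2⌉       ≤⟨ +-mono-≤ half half ⟩
      P + P                           ≡⟨ cong (P +_) (sym (+-identityʳ P)) ⟩
      2 * P                           ∎
      where
        open ≤-Reasoning
        P : ℕ
        P = 2 ^ ⌈log2⌉ (suc ⌈ m /2⌉) (rs (⌈n/2⌉<n m))
        half : suc ⌈ m /2⌉ ≤ P
        half = go (suc ⌈ m /2⌉) (rs (⌈n/2⌉<n m))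

⌈log₂n⌉≤k : ∀ {n} k → n ≤ 2 ^ k → ⌈log₂ n ⌉ ≤ k
⌈log₂n⌉≤k k n≤2^k = subst (_ ≤_) (⌈log₂2^n⌉≡n k) (⌈log₂⌉-mono-≤ n≤2^k)

lg-mono-≤ : ∀ {x y} → x ≤ y → lg x ≤ lg y
lg-mono-≤ x≤y = ⌈log₂⌉-mono-≤ (+-monoʳ-≤ 2 x≤y)

lg-suc : ∀ x → lg (suc x) ≤ suc (lg x)
lg-suc x = ⌈log₂n⌉≤k (suc (lg x)) (begin
  3 + x                ≤⟨ m≤m+n (3 + x) (1 + x) ⟩
  3 + x + (1 + x)      ≡⟨ solve 1 (λ x → con 3 :+ x :+ (con 1 :+ x) := con 2 :* (con 2 :+ x)) refl x ⟩
  2 * (2 + x)          ≤⟨ *-monoʳ-≤ 2 (n≤2^⌈log₂n⌉ (2 + x)) ⟩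
  2 * 2 ^ lg x         ∎)
  where open ≤-Reasoning

lg-* : ∀ x y → lg (x * y) ≤ lg x + lg y
lg-* x y = ⌈log₂n⌉≤k (lg x + lg y) (begin
  2 + x * y               ≤⟨ m≤m+n (2 + x * y) (2 + 2 * x + 2 * y) ⟩
  2 + x * y + (2 + 2 * x + 2 * y)
    ≡⟨ solve 2 (λ x y → con 2 :+ x :* y :+ (con 2 :+ con 2 :* x :+ con 2 :* y)
                      := (con 2 :+ x) :* (con 2 :+ y)) refl x y ⟩
  (2 + x) * (2 + y)       ≤⟨ *-mono-≤ (n≤2^⌈log₂n⌉ (2 + x)) (n≤2^⌈log₂n⌉ (2 + y)) ⟩
  2 ^ lg x * 2 ^ lg y     ≡⟨ sym (^-distribˡ-+-* 2 (lg x) (lg y)) ⟩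
  2 ^ (lg x + lg y)       ∎)
  where open ≤-Reasoning

sumBelow : (ℕ → ℕ) → ℕ → ℕ
sumBelow f zero    = 0
sumBelow f (suc m) = sumBelow f m + f m

sumBelow-≤ : ∀ {f M} → (∀ k → f k ≤ M) → ∀ m → sumBelow f m ≤ m * M
sumBelow-≤ f≤M zero    = z≤n
sumBelow-≤ {f} {M} f≤M (suc m) = begin
  sumBelow f m + f m  ≤⟨ +-mono-≤ (sumBelow-≤ f≤M m) (f≤M m) ⟩
  m * M + M           ≡⟨ +-comm (m * M) M ⟩
  suc m * M           ∎
  where open ≤-Reasoning

0<nCk : ∀ {n k} → k ≤ n → 0 < n C k
0<nCk {n}     {zero}  _         = s≤s z≤n
0<nCk {suc n} {suc k} (s≤s k≤n) =
  subst (0 <_) (nCk+nC[k+1]≡[n+1]C[k+1] n k) (≤-trans (0<nCk k≤n) (m≤m+n _ _))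

n≤nCk : ∀ {n k} → 0 < k → k < n → n ≤ n C k
n≤nCk {suc n} {suc zero}    _ _ = ≤-reflexive (sym (nC1≡n (suc n)))
n≤nCk {suc n} {suc (suc k)} _ (s≤s 1+k<n) =
  subst (suc n ≤_) (nCk+nC[k+1]≡[n+1]C[k+1] n (suc k))
    (subst (_≤ n C suc k + n C suc (suc k)) (+-comm n 1)
      (+-mono-≤ (n≤nCk (s≤s z≤n) 1+k<n) (0<nCk 1+k<n)))

module BinomialTerms (a b : ℕ) where

  term : ℕ → ℕ → ℕ
  term zero    zero    = 1
  term zero    (suc k) = 0
  term (suc n) zero    = b * term n zero
  term (suc n) (suc k) = a * term n k + b * term n (suc k)

  term-vanishes : ∀ {n k} → n < k → term n k ≡ 0
  term-vanishes {zero}  {suc k} _ = refl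
  term-vanishes {suc n} {suc k} (s≤s n<k)
    rewrite term-vanishes n<k | term-vanishes (m<n⇒m<1+n n<k) = cong₂ _+_ (*-zeroʳ a) (*-zeroʳ b)

  term-closed : ∀ n k → term n k ≡ (n C k) * a ^ k * b ^ (n ∸ k)
  term-closed zero    zero    = refl
  term-closed zero    (suc k) = refl
  term-closed (suc n) zero    = trans (cong (b *_) (term-closed n zero))
    (solve 2 (λ b x → b :* (con 1 :* con 1 :* x) := con 1 :* con 1 :* (b :* x)) refl b (b ^ n))
  term-closed (suc n) (suc k) with k <? n
  ... | yes k<n = begin
    a * term n k + b * term n (suc k)
      ≡⟨ cong₂ (λ p q → a * p + b * q) (term-closed n k) (term-closed n (suc k)) ⟩
    a * ((n C k) * a ^ k * b ^ (n ∸ k)) + b * ((n C suc k) * a ^ suc k * b ^ (n ∸ suc k))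
      ≡⟨ cong (λ e → a * ((n C k) * a ^ k * b ^ e) + b * ((n C suc k) * a ^ suc k * b ^ (n ∸ suc k)))
              (+-∸-assoc 1 k<n) ⟩
    a * ((n C k) * a ^ k * (b * b ^ (n ∸ suc k))) + b * ((n C suc k) * (a * a ^ k) * b ^ (n ∸ suc k))
      ≡⟨ solve 6 (λ a b c d x y → a :* (c :* x :* (b :* y)) :+ b :* (d :* (a :* x) :* y)
                                := (c :+ d) :* (a :* x) :* (b :* y))
               refl a b (n C k) (n C suc k) (a ^ k) (b ^ (n ∸ suc k)) ⟩
    (n C k + n C suc k) * (a * a ^ k) * (b * b ^ (n ∸ suc k))
      ≡⟨ cong₂ (λ c e → c * (a * a ^ k) * b ^ e)
               (nCk+nC[k+1]≡[n+1]C[k+1] n k) (sym (+-∸-assoc 1 k<n)) ⟩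
    (suc n C suc k) * a ^ suc k * b ^ (n ∸ k) ∎
    where open ≡-Reasoning
  ... | no k≮n = begin
    a * term n k + b * term n (suc k)
      ≡⟨ cong₂ (λ p q → a * p + b * q) (term-closed n k) (term-vanishes (s≤s (≮⇒≥ k≮n))) ⟩
    a * ((n C k) * a ^ k * b ^ (n ∸ k)) + b * 0
      ≡⟨ solve 5 (λ a b c x y → a :* (c :* x :* y) :+ b :* con 0 := (c :+ con 0) :* (a :* x) :* y)
               refl a b (n C k) (a ^ k) (b ^ (n ∸ k)) ⟩
    (n C k + 0) * (a * a ^ k) * b ^ (n ∸ k)
      ≡⟨ cong (λ c → (n C k + c) * (a * a ^ k) * b ^ (n ∸ k)) (sym (k>n⇒nCk≡0 (s≤s (≮⇒≥ k≮n)))) ⟩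
    (n C k + n C suc k) * (a * a ^ k) * b ^ (n ∸ k)
      ≡⟨ cong (λ c → c * (a * a ^ k) * b ^ (n ∸ k)) (nCk+nC[k+1]≡[n+1]C[k+1] n k) ⟩
    (suc n C suc k) * a ^ suc k * b ^ (n ∸ k) ∎
    where open ≡-Reasoning

  sumBelow-term-suc : ∀ n m →
    sumBelow (term (suc n)) (suc m) ≡ a * sumBelow (term n) m + b * sumBelow (term n) (suc m)
  sumBelow-term-suc n zero =
    solve 3 (λ a b x → con 0 :+ b :* x := a :* con 0 :+ b :* (con 0 :+ x)) refl a b (term n zero)
  sumBelow-term-suc n (suc m) = begin
    sumBelow (term (suc n)) (suc m) + (a * x + b * y)
      ≡⟨ cong (_+ (a * x + b * y)) (sumBelow-term-suc n m) ⟩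
    a * s + b * (s + x) + (a * x + b * y)
      ≡⟨ solve 5 (λ a b s x y → a :* s :+ b :* (s :+ x) :+ (a :* x :+ b :* y)
                              := a :* (s :+ x) :+ b :* (s :+ x :+ y)) refl a b s x y ⟩
    a * (s + x) + b * (s + x + y) ∎
    where
      open ≡-Reasoning
      s x y : ℕ
      s = sumBelow (term n) m
      x = term n m
      y = term n (suc m)

  binomial : ∀ n → sumBelow (term n) (suc n) ≡ (a + b) ^ n
  binomial zero    = refl
  binomial (suc n) = begin
    sumBelow (term (suc n)) (suc (suc n))  ≡⟨ sumBelow-term-suc n (suc n) ⟩
    a * s + b * (s + term n (suc n))       ≡⟨ cong (λ z → a * s + b * (s + z)) (term-vanishes (n<1+n n)) ⟩
    a * s + b * (s + 0)                    ≡⟨ cong (λ z → a * s + b * z) (+-identityʳ s) ⟩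
    a * s + b * s                          ≡⟨ sym (*-distribʳ-+ s a b) ⟩
    (a + b) * s                            ≡⟨ cong ((a + b) *_) (binomial n) ⟩
    (a + b) ^ suc n                        ∎
    where
      open ≡-Reasoning
      s : ℕ
      s = sumBelow (term n) (suc n)

  term-ratio : ∀ n k → suc k * b * term n (suc k) ≡ (n ∸ k) * a * term n k
  term-ratio zero    zero    = *-zeroʳ (1 * b)
  term-ratio zero    (suc k) = *-zeroʳ (suc (suc k) * b)
  term-ratio (suc n) zero    = begin
    (b + 0) * (a * x + b * y)
      ≡⟨ solve 4 (λ a b x y → (b :+ con 0) :* (a :* x :+ b :* y) := b :* a :* x :+ b :* ((b :+ con 0) :* y))
               refl a b x y ⟩
    b * a * x + b * ((b + 0) * y)  ≡⟨ cong (λ z → b * a * x + b * z) (term-ratio n zero) ⟩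
    b * a * x + b * (n * a * x)
      ≡⟨ solve 4 (λ a b x n → b :* a :* x :+ b :* (n :* a :* x) := (con 1 :+ n) :* a :* (b :* x)) refl a b x n ⟩
    suc n * a * (b * x)            ∎
    where
      open ≡-Reasoning
      x y : ℕ
      x = term n zero
      y = term n 1
  term-ratio (suc n) (suc k) with k <? n
  ... | yes k<n = begin
    suc (suc k) * b * (a * y + b * z)
      ≡⟨ solve 5 (λ a b k y z → (con 2 :+ k) :* b :* (a :* y :+ b :* z)
                              := a :* b :* y :+ a :* ((con 1 :+ k) :* b :* y) :+ b :* ((con 2 :+ k) :* b :* z))
               refl a b k y z ⟩
    a * b * y + a * (suc k * b * y) + b * (suc (suc k) * b * z)
      ≡⟨ cong₂ (λ p q → a * b * y + a * p + b * q) (term-ratio n k) (term-ratio n (suc k)) ⟩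
    a * b * y + a * ((n ∸ k) * a * x) + b * ((n ∸ suc k) * a * y)
      ≡⟨ cong (λ d → a * b * y + a * (d * a * x) + b * ((n ∸ suc k) * a * y)) (+-∸-assoc 1 k<n) ⟩
    a * b * y + a * ((1 + (n ∸ suc k)) * a * x) + b * ((n ∸ suc k) * a * y)
      ≡⟨ solve 5 (λ a b d x y → a :* b :* y :+ a :* ((con 1 :+ d) :* a :* x) :+ b :* (d :* a :* y)
                              := (con 1 :+ d) :* a :* (a :* x :+ b :* y))
               refl a b (n ∸ suc k) x y ⟩
    (1 + (n ∸ suc k)) * a * (a * x + b * y)
      ≡⟨ cong (λ d → d * a * (a * x + b * y)) (sym (+-∸-assoc 1 k<n)) ⟩
    (n ∸ k) * a * (a * x + b * y) ∎
    where
      open ≡-Reasoning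
      x y z : ℕ
      x = term n k
      y = term n (suc k)
      z = term n (suc (suc k))
  ... | no k≮n
    rewrite term-vanishes {n} {suc k} (s≤s (≮⇒≥ k≮n))
          | term-vanishes {n} {suc (suc k)} (s≤s (m≤n⇒m≤1+n (≮⇒≥ k≮n)))
          | m≤n⇒m∸n≡0 (≮⇒≥ k≮n)
    = solve 4 (λ a b k x → (con 2 :+ k) :* b :* (a :* con 0 :+ b :* con 0) := con 0) refl a b k (term n k)

  module _ .{{_ : NonZero b}} where

    term-rising : ∀ {k} → k < a → term (a + b) k ≤ term (a + b) (suc k)
    term-rising {k} k<a = *-cancelˡ-≤ (suc k * b) {{m*n≢0 (suc k) b}} (begin
      suc k * b * term (a + b) k        ≤⟨ *-monoˡ-≤ (term (a + b) k) (*-mono-≤ k<a b≤a+b∸k) ⟩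
      a * (a + b ∸ k) * term (a + b) k  ≡⟨ cong (_* term (a + b) k) (*-comm a (a + b ∸ k)) ⟩
      (a + b ∸ k) * a * term (a + b) k  ≡⟨ sym (term-ratio (a + b) k) ⟩
      suc k * b * term (a + b) (suc k)  ∎)
      where
        open ≤-Reasoning
        b≤a+b∸k : b ≤ a + b ∸ k
        b≤a+b∸k = subst (_≤ a + b ∸ k) (m+n∸m≡n a b) (∸-monoʳ-≤ (a + b) (<⇒≤ k<a))

    term-falling : ∀ {k} → a ≤ k → term (a + b) (suc k) ≤ term (a + b) k
    term-falling {k} a≤k = *-cancelˡ-≤ (suc k * b) {{m*n≢0 (suc k) b}} (begin
      suc k * b * term (a + b) (suc k)  ≡⟨ term-ratio (a + b) k ⟩
      (a + b ∸ k) * a * term (a + b) k  ≡⟨ cong (_* term (a + b) k) (*-comm (a + b ∸ k) a) ⟩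
      a * (a + b ∸ k) * term (a + b) k  ≤⟨ *-monoˡ-≤ (term (a + b) k) (*-mono-≤ (m≤n⇒m≤1+n a≤k) a+b∸k≤b) ⟩
      suc k * b * term (a + b) k        ∎)
      where
        open ≤-Reasoning
        a+b∸k≤b : a + b ∸ k ≤ b
        a+b∸k≤b = subst (a + b ∸ k ≤_) (m+n∸m≡n a b) (∸-monoʳ-≤ (a + b) a≤k)

    entropy-bound : (a + b) ^ (a + b) ≤ suc (a + b) * (((a + b) C a) * a ^ a * b ^ b)
    entropy-bound = begin
      (a + b) ^ (a + b)                      ≡⟨ sym (binomial (a + b)) ⟩
      sumBelow (term (a + b)) (suc (a + b))
        ≤⟨ sumBelow-≤ (unimodal-max (term (a + b)) a term-rising term-falling) (suc (a + b)) ⟩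
      suc (a + b) * term (a + b) a           ≡⟨ cong (suc (a + b) *_) (term-closed (a + b) a) ⟩
      suc (a + b) * (((a + b) C a) * a ^ a * b ^ (a + b ∸ a))
        ≡⟨ cong (λ e → suc (a + b) * (((a + b) C a) * a ^ a * b ^ e)) (m+n∸m≡n a b) ⟩
      suc (a + b) * (((a + b) C a) * a ^ a * b ^ b) ∎
      where open ≤-Reasoning

𝟙 : Bool → ℕ
𝟙 true  = 1
𝟙 false = 0

module Greedy {X Y : Set} (covers : X → Y → Bool) where

  hits : X → List Y → List Y
  hits S = filterᵇ (covers S)

  misses : X → List Y → List Y
  misses S = filterᵇ (not ∘ covers S)

  length-hits-∷ : ∀ S p U → length (hits S (p ∷ U)) ≡ 𝟙 (covers S p) + length (hits S U)
  length-hits-∷ S p U with covers S p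
  ... | true  = refl
  ... | false = refl

  length-hits+misses : ∀ S U → length (hits S U) + length (misses S U) ≡ length U
  length-hits+misses S []      = refl
  length-hits+misses S (p ∷ U) with covers S p
  ... | true  = cong suc (length-hits+misses S U)
  ... | false = trans (+-suc _ _) (cong suc (length-hits+misses S U))

  uncovered : List X → List Y → List Y
  uncovered []      U = U
  uncovered (S ∷ L) U = uncovered L (misses S U)

  uncovered≡[]⇒covered : ∀ L {U p} → uncovered L U ≡ [] → p ∈ U → ∃ λ S → S ∈ L × T (covers S p)
  uncovered≡[]⇒covered []      refl ()
  uncovered≡[]⇒covered (S ∷ L) {p = p} none p∈U with covers S p in eq
  ... | true  = S , here refl , subst T (sym eq) _
  ... | false
    with uncovered≡[]⇒covered L none (∈-filter⁺ (T? ∘ (not ∘ covers S)) p∈U (subst (T ∘ not) (sym eq) _))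
  ...   | S′ , S′∈L , S′-covers = S′ , there S′∈L , S′-covers

  module _ {Good : Y → Set} (N D : ℕ)
           (dense : ∀ {U} → All Good U → ∃ λ S → length U * N ≤ length (hits S U) * D) where

    greedy-step : ∀ {U} → All Good U → ∃ λ S → length (misses S U) * D ≤ length U * (D ∸ N)
    greedy-step {U} good with dense good
    ... | S , U*N≤hits*D = S , (begin
      length (misses S U) * D          ≡⟨ sym (m+n∸m≡n (h * D) (length (misses S U) * D)) ⟩
      h * D + length (misses S U) * D ∸ h * D
        ≡⟨ cong (_∸ h * D) (trans (sym (*-distribʳ-+ D h _)) (cong (_* D) (length-hits+misses S U))) ⟩
      length U * D ∸ h * D             ≤⟨ ∸-monoʳ-≤ (length U * D) U*N≤hits*D ⟩
      length U * D ∸ length U * N      ≡⟨ sym (*-distribˡ-∸ (length U) D N) ⟩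
      length U * (D ∸ N)               ∎)
      where
        open ≤-Reasoning
        h : ℕ
        h = length (hits S U)

    greedy : ∀ k {U} → All Good U →
             ∃ λ L → length L ≡ k × length (uncovered L U) * D ^ k ≤ length U * (D ∸ N) ^ k
    greedy zero    good = [] , refl , ≤-refl
    greedy (suc k) {U} good with greedy-step good
    ... | S , shrink with greedy k (All.filter⁺ (T? ∘ (not ∘ covers S)) good)
    ...   | L , refl , ih = S ∷ L , refl , (begin
      length (uncovered L (misses S U)) * (D * D ^ k)  ≡⟨ x∙yz≈xz∙y (length (uncovered L (misses S U))) D (D ^ k) ⟩
      length (uncovered L (misses S U)) * D ^ k * D    ≤⟨ *-monoˡ-≤ D ih ⟩
      length (misses S U) * E ^ k * D                  ≡⟨ xy∙z≈xz∙y (length (misses S U)) (E ^ k) D ⟩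
      length (misses S U) * D * E ^ k                  ≤⟨ *-monoˡ-≤ (E ^ k) shrink ⟩
      length U * E * E ^ k                             ≡⟨ *-assoc (length U) E (E ^ k) ⟩
      length U * (E * E ^ k)                           ∎)
      where
        open ≤-Reasoning
        E : ℕ
        E = D ∸ N

separates : ∀ {u} → Subset u → Subset u × Subset u → Bool
separates []            ([]    , [])    = true
separates (inside  ∷ S) (_ ∷ A , y ∷ B) = not y ∧ separates S (A , B)
separates (outside ∷ S) (x ∷ A , _ ∷ B) = not x ∧ separates S (A , B)

separates⇒⊆ : ∀ {u} (S A B : Subset u) → T (separates S (A , B)) → A ⊆ S
separates⇒⊆ (inside  ∷ S) (_ ∷ A)       (outside ∷ B) _ here      = here
separates⇒⊆ (inside  ∷ S) (_ ∷ A)       (outside ∷ B) t (there i) = there (separates⇒⊆ S A B t i)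
separates⇒⊆ (outside ∷ S) (outside ∷ A) (_ ∷ B)       t (there i) = there (separates⇒⊆ S A B t i)

separates⇒⊆∁ : ∀ {u} (S A B : Subset u) → T (separates S (A , B)) → B ⊆ ∁ S
separates⇒⊆∁ (inside  ∷ S) (_ ∷ A)       (outside ∷ B) t (there i) = there (separates⇒⊆∁ S A B t i)
separates⇒⊆∁ (outside ∷ S) (outside ∷ A) (_ ∷ B)       _ here      = here
separates⇒⊆∁ (outside ∷ S) (outside ∷ A) (_ ∷ B)       t (there i) = there (separates⇒⊆∁ S A B t i)

extend : ∀ {u} → Side → Side → Subset u × Subset u → Subset (suc u) × Subset (suc u)
extend x y (A , B) = x ∷ A , y ∷ B

disjointPairs : (u α β : ℕ) → List (Subset u × Subset u)
pairsWithA : (u α β : ℕ) → List (Subset (suc u) × Subset (suc u))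
pairsWithB : (u α β : ℕ) → List (Subset (suc u) × Subset (suc u))

disjointPairs zero    α β = [ [] , [] ]
disjointPairs (suc u) α β =
  map (extend outside outside) (disjointPairs u α β) ++ pairsWithA u α β ++ pairsWithB u α β

pairsWithA u zero    β = []
pairsWithA u (suc α) β = map (extend inside outside) (disjointPairs u α β)

pairsWithB u α zero    = []
pairsWithB u α (suc β) = map (extend outside inside) (disjointPairs u α β)

disjointPairs-complete : ∀ {u α β} (A B : Subset u) → ∣ A ∣ ≤ α → ∣ B ∣ ≤ β → Empty (A ∩ B) →
                         (A , B) ∈ disjointPairs u α β
disjointPairs-complete []            []            _ _ _ = here refl
disjointPairs-complete (inside ∷ A)  (inside ∷ B)  _ _ A∩B=∅ = ⊥-elim (A∩B=∅ (zero , here))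
disjointPairs-complete {suc u} {α} {β} (outside ∷ A) (outside ∷ B) ∣A∣≤α ∣B∣≤β A∩B=∅ =
  ∈-++⁺ˡ (∈-map⁺ (extend outside outside)
    (disjointPairs-complete A B ∣A∣≤α ∣B∣≤β (drop-∷-Empty A∩B=∅)))
disjointPairs-complete {suc u} {suc α} {β} (inside ∷ A) (outside ∷ B) (s≤s ∣A∣≤α) ∣B∣≤β A∩B=∅ =
  ∈-++⁺ʳ (map (extend outside outside) (disjointPairs u (suc α) β)) (∈-++⁺ˡ (∈-map⁺ (extend inside outside)
    (disjointPairs-complete A B ∣A∣≤α ∣B∣≤β (drop-∷-Empty A∩B=∅))))
disjointPairs-complete {suc u} {α} {suc β} (outside ∷ A) (inside ∷ B) ∣A∣≤α (s≤s ∣B∣≤β) A∩B=∅ =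
  ∈-++⁺ʳ (map (extend outside outside) (disjointPairs u α (suc β))) (∈-++⁺ʳ (pairsWithA u α (suc β))
    (∈-map⁺ (extend outside inside) (disjointPairs-complete A B ∣A∣≤α ∣B∣≤β (drop-∷-Empty A∩B=∅))))

predPow : ℕ → ℕ → ℕ
predPow x zero    = 0
predPow x (suc α) = x ^ α

^+predPow≤suc^ : ∀ x α → x ^ α + predPow x α ≤ suc x ^ α
^+predPow≤suc^ x zero    = s≤s z≤n
^+predPow≤suc^ x (suc α) = begin
  x * x ^ α + x ^ α    ≡⟨ +-comm (x * x ^ α) (x ^ α) ⟩
  suc x * x ^ α        ≤⟨ *-monoʳ-≤ (suc x) (^-monoˡ-≤ α (n≤1+n x)) ⟩
  suc x * suc x ^ α    ∎
  where open ≤-Reasoning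

length-disjointPairs : ∀ u α β → length (disjointPairs u α β) ≤ suc u ^ α * suc u ^ β
length-pairsWithA : ∀ u α β → length (pairsWithA u α β) ≤ predPow (suc u) α * suc u ^ β
length-pairsWithB : ∀ u α β → length (pairsWithB u α β) ≤ suc u ^ α * predPow (suc u) β

length-disjointPairs zero α β = ≤-reflexive (sym (cong₂ _*_ (^-zeroˡ α) (^-zeroˡ β)))
length-disjointPairs (suc u) α β = begin
  length (map (extend outside outside) (disjointPairs u α β) ++ pairsWithA u α β ++ pairsWithB u α β)
    ≡⟨ length-++ (map (extend outside outside) (disjointPairs u α β)) ⟩
  length (map (extend outside outside) (disjointPairs u α β)) + length (pairsWithA u α β ++ pairsWithB u α β)
    ≡⟨ cong₂ _+_ (length-map (extend outside outside) (disjointPairs u α β)) (length-++ (pairsWithA u α β)) ⟩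
  length (disjointPairs u α β) + (length (pairsWithA u α β) + length (pairsWithB u α β))
    ≤⟨ +-mono-≤ (length-disjointPairs u α β) (+-mono-≤ (length-pairsWithA u α β) (length-pairsWithB u α β)) ⟩
  p * q + (p′ * q + p * q′)
    ≤⟨ m≤m+n (p * q + (p′ * q + p * q′)) (p′ * q′) ⟩
  p * q + (p′ * q + p * q′) + p′ * q′
    ≡⟨ solve 4 (λ p q p′ q′ → p :* q :+ (p′ :* q :+ p :* q′) :+ p′ :* q′ := (p :+ p′) :* (q :+ q′)) refl p q p′ q′ ⟩
  (p + p′) * (q + q′)
    ≤⟨ *-mono-≤ (^+predPow≤suc^ (suc u) α) (^+predPow≤suc^ (suc u) β) ⟩
  suc (suc u) ^ α * suc (suc u) ^ β ∎
  where
    open ≤-Reasoning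
    p q p′ q′ : ℕ
    p  = suc u ^ α
    q  = suc u ^ β
    p′ = predPow (suc u) α
    q′ = predPow (suc u) β

length-pairsWithA u zero    β = z≤n
length-pairsWithA u (suc α) β =
  ≤-trans (≤-reflexive (length-map (extend inside outside) (disjointPairs u α β))) (length-disjointPairs u α β)

length-pairsWithB u α zero    = z≤n
length-pairsWithB u α (suc β) =
  ≤-trans (≤-reflexive (length-map (extend outside inside) (disjointPairs u α β))) (length-disjointPairs u α β)

module SeparationGreedy {u : ℕ} = Greedy (separates {u})

length*≤sum-map* : ∀ {A : Set} {c D : ℕ} (f : A → ℕ) {xs : List A} →
                   All (λ x → c ≤ f x * D) xs → length xs * c ≤ sum (map f xs) * D
length*≤sum-map* f []                    = z≤n
length*≤sum-map* {c = c} {D} f {x ∷ xs} (c≤fx*D ∷ rest) = begin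
  c + length xs * c                 ≤⟨ +-mono-≤ c≤fx*D (length*≤sum-map* f rest) ⟩
  f x * D + sum (map f xs) * D      ≡⟨ sym (*-distribʳ-+ D (f x) (sum (map f xs))) ⟩
  (f x + sum (map f xs)) * D        ∎
  where open ≤-Reasoning

module Weighted (a b : ℕ) where

  -- The sum over all S ⊆ {1..u} of a ^ ∣S∣ * b ^ (u ∸ ∣S∣) * f S: up to the factor (a + b) ^ u, the
  -- expectation of f at a random S containing each point independently with probability a / (a + b).
  weightedSum : ∀ {u} → (Subset u → ℕ) → ℕ
  weightedSum {zero}  f = f []
  weightedSum {suc u} f = a * weightedSum (f ∘ (inside ∷_)) + b * weightedSum (f ∘ (outside ∷_))

  weightedSum-cong : ∀ {u} {f g : Subset u → ℕ} → (∀ S → f S ≡ g S) → weightedSum f ≡ weightedSum g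
  weightedSum-cong {zero}  f≗g = f≗g []
  weightedSum-cong {suc u} f≗g =
    cong₂ (λ x y → a * x + b * y) (weightedSum-cong (f≗g ∘ (inside ∷_))) (weightedSum-cong (f≗g ∘ (outside ∷_)))

  weightedSum-0 : ∀ {u} → weightedSum {u} (λ _ → 0) ≡ 0
  weightedSum-0 {zero}  = refl
  weightedSum-0 {suc u} rewrite weightedSum-0 {u} = cong₂ _+_ (*-zeroʳ a) (*-zeroʳ b)

  weightedSum-+ : ∀ {u} (f g : Subset u → ℕ) → weightedSum (λ S → f S + g S) ≡ weightedSum f + weightedSum g
  weightedSum-+ {zero}  f g = refl
  weightedSum-+ {suc u} f g
    rewrite weightedSum-+ (f ∘ (inside ∷_)) (g ∘ (inside ∷_)) | weightedSum-+ (f ∘ (outside ∷_)) (g ∘ (outside ∷_))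
    = solve 6 (λ a b x y x′ y′ → a :* (x :+ x′) :+ b :* (y :+ y′) := a :* x :+ b :* y :+ (a :* x′ :+ b :* y′))
              refl a b (weightedSum (f ∘ (inside ∷_))) (weightedSum (f ∘ (outside ∷_)))
                       (weightedSum (g ∘ (inside ∷_))) (weightedSum (g ∘ (outside ∷_)))

  weightedSum-suc-≤ : ∀ {u M} (f : Subset (suc u) → ℕ) →
                      weightedSum (f ∘ (inside ∷_)) ≤ M * (a + b) ^ u →
                      weightedSum (f ∘ (outside ∷_)) ≤ M * (a + b) ^ u →
                      weightedSum f ≤ M * (a + b) ^ suc u
  weightedSum-suc-≤ {u} {M} f insides≤ outsides≤ = begin
    a * weightedSum (f ∘ (inside ∷_)) + b * weightedSum (f ∘ (outside ∷_))
      ≤⟨ +-mono-≤ (*-monoʳ-≤ a insides≤) (*-monoʳ-≤ b outsides≤) ⟩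
    a * (M * (a + b) ^ u) + b * (M * (a + b) ^ u)
      ≡⟨ solve 4 (λ a b M p → a :* (M :* p) :+ b :* (M :* p) := M :* ((a :+ b) :* p)) refl a b M ((a + b) ^ u) ⟩
    M * (a + b) ^ suc u ∎
    where open ≤-Reasoning

  weightedSum-averaging : ∀ {u} (f : Subset u → ℕ) → ∃ λ S → weightedSum f ≤ f S * (a + b) ^ u
  weightedSum-averaging {zero}  f = [] , ≤-reflexive (sym (*-identityʳ (f [])))
  weightedSum-averaging {suc u} f
    with weightedSum-averaging (f ∘ (inside ∷_)) | weightedSum-averaging (f ∘ (outside ∷_))
  ... | S₁ , avg₁ | S₂ , avg₂ with ≤-total (f (inside ∷ S₁)) (f (outside ∷ S₂))
  ...   | inj₁ f₁≤f₂ = outside ∷ S₂ ,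
    weightedSum-suc-≤ {M = f (outside ∷ S₂)} f (≤-trans avg₁ (*-monoˡ-≤ ((a + b) ^ u) f₁≤f₂)) avg₂
  ...   | inj₂ f₂≤f₁ = inside ∷ S₁ ,
    weightedSum-suc-≤ {M = f (inside ∷ S₁)} f avg₁ (≤-trans avg₂ (*-monoˡ-≤ ((a + b) ^ u) f₂≤f₁))

  separatingWeight : ∀ {u} → Subset u × Subset u → ℕ
  separatingWeight p = weightedSum (λ S → 𝟙 (separates S p))

  -- p is separated by a random S with probability at least (a / (a + b)) ^ α * (b / (a + b)) ^ β.
  Heavy : ∀ {u} → ℕ → ℕ → Subset u × Subset u → Set
  Heavy {u} α β p = a ^ α * b ^ β * (a + b) ^ u ≤ separatingWeight p * (a + b) ^ (α + β)

  module _ {u α β} {p : Subset u × Subset u} (heavy : Heavy α β p) where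
    private
      n w x P : ℕ
      n = a + b
      w = separatingWeight p
      x = a ^ α * b ^ β * n ^ u
      P = n ^ (α + β)

    heavy-extend-outside-outside : Heavy α β (extend outside outside p)
    heavy-extend-outside-outside = begin
      a ^ α * b ^ β * (n * n ^ u)  ≡⟨ x∙yz≈y∙xz (a ^ α * b ^ β) n (n ^ u) ⟩
      n * x                        ≤⟨ *-monoʳ-≤ n heavy ⟩
      n * (w * P)                  ≡⟨ sym (*-assoc n w P) ⟩
      n * w * P                    ≡⟨ cong (_* P) (*-distribʳ-+ w a b) ⟩
      (a * w + b * w) * P          ∎
      where open ≤-Reasoning

    heavy-extend-inside-outside : Heavy (suc α) β (extend inside outside p)
    heavy-extend-inside-outside = begin
      a * a ^ α * b ^ β * (n * n ^ u)
        ≡⟨ solve 5 (λ a x y n z → a :* x :* y :* (n :* z) := a :* n :* (x :* y :* z)) refl a (a ^ α) (b ^ β) n (n ^ u) ⟩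
      a * n * x                                  ≤⟨ *-monoʳ-≤ (a * n) heavy ⟩
      a * n * (w * P)
        ≡⟨ solve 4 (λ a n w P → a :* n :* (w :* P) := (a :* w :+ con 0) :* (n :* P)) refl a n w P ⟩
      (a * w + 0) * (n * P)                      ≡⟨ cong (λ z → (a * w + z) * (n * P)) (sym zero-weight) ⟩
      (a * w + b * weightedSum {u} (λ _ → 0)) * (n * P) ∎
      where
        open ≤-Reasoning
        zero-weight : b * weightedSum {u} (λ _ → 0) ≡ 0
        zero-weight = trans (cong (b *_) (weightedSum-0 {u})) (*-zeroʳ b)

    heavy-extend-outside-inside : Heavy α (suc β) (extend outside inside p)
    heavy-extend-outside-inside = begin
      a ^ α * (b * b ^ β) * (n * n ^ u)
        ≡⟨ solve 5 (λ b x y n z → x :* (b :* y) :* (n :* z) := b :* n :* (x :* y :* z)) refl b (a ^ α) (b ^ β) n (n ^ u) ⟩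
      b * n * x                                  ≤⟨ *-monoʳ-≤ (b * n) heavy ⟩
      b * n * (w * P)
        ≡⟨ solve 4 (λ b n w P → b :* n :* (w :* P) := (con 0 :+ b :* w) :* (n :* P)) refl b n w P ⟩
      (0 + b * w) * (n * P)                      ≡⟨ cong (λ z → (z + b * w) * (n * P)) (sym zero-weight) ⟩
      (a * weightedSum {u} (λ _ → 0) + b * w) * (n * P)
        ≡⟨ cong (λ e → (a * weightedSum {u} (λ _ → 0) + b * w) * n ^ e) (sym (+-suc α β)) ⟩
      (a * weightedSum {u} (λ _ → 0) + b * w) * n ^ (α + suc β) ∎
      where
        open ≤-Reasoning
        zero-weight : a * weightedSum {u} (λ _ → 0) ≡ 0
        zero-weight = trans (cong (a *_) (weightedSum-0 {u})) (*-zeroʳ a)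

  disjointPairs-heavy : ∀ u α β → All (Heavy α β) (disjointPairs u α β)
  pairsWithA-heavy : ∀ u α β → All (Heavy α β) (pairsWithA u α β)
  pairsWithB-heavy : ∀ u α β → All (Heavy α β) (pairsWithB u α β)

  disjointPairs-heavy zero α β = (begin
    a ^ α * b ^ β * 1      ≡⟨ *-identityʳ (a ^ α * b ^ β) ⟩
    a ^ α * b ^ β          ≤⟨ ^*^≤[+]^[+] a b α β ⟩
    (a + b) ^ (α + β)      ≡⟨ sym (*-identityˡ ((a + b) ^ (α + β))) ⟩
    1 * (a + b) ^ (α + β)  ∎) ∷ []
    where open ≤-Reasoning
  disjointPairs-heavy (suc u) α β =
    All.++⁺ (All.map⁺ (All.map (heavy-extend-outside-outside {u} {α} {β}) (disjointPairs-heavy u α β)))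
            (All.++⁺ (pairsWithA-heavy u α β) (pairsWithB-heavy u α β))

  pairsWithA-heavy u zero    β = []
  pairsWithA-heavy u (suc α) β =
    All.map⁺ (All.map (heavy-extend-inside-outside {u} {α} {β}) (disjointPairs-heavy u α β))

  pairsWithB-heavy u α zero    = []
  pairsWithB-heavy u α (suc β) =
    All.map⁺ (All.map (heavy-extend-outside-inside {u} {α} {β}) (disjointPairs-heavy u α β))

  open SeparationGreedy using (hits; length-hits-∷)

  weightedSum-hits : ∀ {u} (U : List (Subset u × Subset u)) →
                     weightedSum (λ S → length (hits S U)) ≡ sum (map separatingWeight U)
  weightedSum-hits {u} []      = weightedSum-0 {u}
  weightedSum-hits         (p ∷ U) = begin
    weightedSum (λ S → length (hits S (p ∷ U)))                ≡⟨ weightedSum-cong (λ S → length-hits-∷ S p U) ⟩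
    weightedSum (λ S → 𝟙 (separates S p) + length (hits S U))  ≡⟨ weightedSum-+ (λ S → 𝟙 (separates S p)) _ ⟩
    separatingWeight p + weightedSum (λ S → length (hits S U)) ≡⟨ cong (separatingWeight p +_) (weightedSum-hits U) ⟩
    separatingWeight p + sum (map separatingWeight U)          ∎
    where open ≡-Reasoning

  dense-separator : ∀ {u N D} .{{_ : NonZero (a + b)}} {U : List (Subset u × Subset u)} →
                    All (λ p → N * (a + b) ^ u ≤ separatingWeight p * D) U →
                    ∃ λ S → length U * N ≤ length (hits S U) * D
  dense-separator {u} {N} {D} {U} heavy with weightedSum-averaging (λ S → length (hits S U))
  ... | S , avg = S , *-cancelʳ-≤ (length U * N) (length (hits S U) * D) ((a + b) ^ u) {{m^n≢0 (a + b) u}} (begin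
    length U * N * (a + b) ^ u                  ≡⟨ *-assoc (length U) N ((a + b) ^ u) ⟩
    length U * (N * (a + b) ^ u)                ≤⟨ length*≤sum-map* separatingWeight heavy ⟩
    sum (map separatingWeight U) * D            ≡⟨ cong (_* D) (sym (weightedSum-hits U)) ⟩
    weightedSum (λ S → length (hits S U)) * D   ≤⟨ *-monoˡ-≤ D avg ⟩
    length (hits S U) * (a + b) ^ u * D         ≡⟨ xy∙z≈xz∙y (length (hits S U)) ((a + b) ^ u) D ⟩
    length (hits S U) * D * (a + b) ^ u         ∎)
    where open ≤-Reasoning

Separating : ∀ {u} → ℕ → ℕ → List (Subset u) → Set
Separating {u} a b 𝕊 = (A B : Subset u) → ∣ A ∣ ≤ a → ∣ B ∣ ≤ b → Empty (A ∩ B) →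
                       Σ (Subset u) λ S → (S ∈ 𝕊) × (A ⊆ S) × (B ⊆ ∁ S)

∣A∣≤0⇒A⊆ : ∀ {u} {A : Subset u} X → ∣ A ∣ ≤ 0 → A ⊆ X
∣A∣≤0⇒A⊆ _ ∣A∣≤0 x∈A = ⊥-elim (n≮0 (≤-trans (x∈p⇒∣p-x∣<∣p∣ x∈A) ∣A∣≤0))

[⊥]-separating : ∀ {u} b → Separating 0 b [ ⊥ {u} ]
[⊥]-separating b A B ∣A∣≤0 _ _ = ⊥ , here refl , ∣A∣≤0⇒A⊆ ⊥ ∣A∣≤0 , λ _ → x∉p⇒x∈∁p ∉⊥

[⊤]-separating : ∀ {u} a → Separating a 0 [ ⊤ {u} ]
[⊤]-separating a A B _ ∣B∣≤0 _ = ⊤ , here refl , (λ _ → ∈⊤) , ∣A∣≤0⇒A⊆ (∁ ⊤) ∣B∣≤0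

lg1≤4*[lg+lg] : ∀ x y → lg 1 ≤ 4 * (lg x + lg y)
lg1≤4*[lg+lg] x y = begin
  lg 1               ≤⟨ ⌈log₂n⌉≤k 2 (s≤s (s≤s (s≤s z≤n))) ⟩
  2                  ≤⟨ +-mono-≤ (s≤s z≤n) (s≤s z≤n) ⟩
  lg x + lg y        ≤⟨ m≤n*m (lg x + lg y) 4 ⟩
  4 * (lg x + lg y)  ∎
  where open ≤-Reasoning

module GreedyFamily (a b u : ℕ) .{{_ : NonZero a}} .{{_ : NonZero b}} where

  open BinomialTerms a b using (entropy-bound)
  open Weighted a b using (dense-separator; disjointPairs-heavy)
  open SeparationGreedy using (uncovered; uncovered≡[]⇒covered; greedy)

  n N D E nCa t r rounds : ℕ
  n      = a + b
  N      = a ^ a * b ^ b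
  D      = n ^ n
  E      = D ∸ N
  nCa    = n C a
  t      = suc n * nCa
  r      = lg u * n
  rounds = t * r

  pairs : List (Subset u × Subset u)
  pairs = disjointPairs u a b

  n≤nCa : n ≤ nCa
  n≤nCa = n≤nCk (>-nonZero⁻¹ a) (subst (_≤ n) (+-comm a 1) (+-monoʳ-≤ a (>-nonZero⁻¹ b)))

  instance
    n≢0 : NonZero n
    n≢0 = >-nonZero (≤-trans (>-nonZero⁻¹ a) (m≤m+n a b))

    D≢0 : NonZero D
    D≢0 = m^n≢0 n n

    t≢0 : NonZero t
    t≢0 = m*n≢0 (suc n) nCa {{_}} {{>-nonZero (≤-trans (>-nonZero⁻¹ n) n≤nCa)}}

  run : ∃ λ L → length L ≡ rounds × length (uncovered L pairs) * D ^ rounds ≤ length pairs * E ^ rounds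
  run = greedy N D dense-separator rounds (disjointPairs-heavy u a b)

  family : List (Subset u)
  family = proj₁ run

  length-family : length family ≡ rounds
  length-family = proj₁ (proj₂ run)

  D≤t*N : D ≤ t * N
  D≤t*N = subst (D ≤_) (trans (cong (suc n *_) (*-assoc nCa (a ^ a) (b ^ b))) (sym (*-assoc (suc n) nCa N)))
                entropy-bound

  2^r*E^rounds≤D^rounds : 2 ^ r * E ^ rounds ≤ D ^ rounds
  2^r*E^rounds≤D^rounds = begin
    2 ^ r * E ^ (t * r)  ≡⟨ cong (2 ^ r *_) (sym (^-*-assoc E t r)) ⟩
    2 ^ r * (E ^ t) ^ r  ≤⟨ *-≤⇒^-*-≤ r (halving t (^*^≤[+]^[+] a b a b) D≤t*N) ⟩
    (D ^ t) ^ r          ≡⟨ ^-*-assoc D t r ⟩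
    D ^ (t * r)          ∎
    where open ≤-Reasoning

  length-pairs<2^r : length pairs < 2 ^ r
  length-pairs<2^r = begin-strict
    length pairs           ≤⟨ length-disjointPairs u a b ⟩
    suc u ^ a * suc u ^ b  ≡⟨ sym (^-distribˡ-+-* (suc u) a b) ⟩
    suc u ^ n              <⟨ ^-monoˡ-< n (n<1+n (suc u)) ⟩
    (2 + u) ^ n            ≤⟨ ^-monoˡ-≤ n (n≤2^⌈log₂n⌉ (2 + u)) ⟩
    (2 ^ lg u) ^ n         ≡⟨ ^-*-assoc 2 (lg u) n ⟩
    2 ^ r                  ∎
    where open ≤-Reasoning

  uncovered≡[] : uncovered family pairs ≡ []
  uncovered≡[] with uncovered family pairs | proj₂ (proj₂ run)
  ... | []    | _        = refl
  ... | _ ∷ _ | leftover = ⊥-elim (<⇒≱ few (≤-trans (m≤m+n (D ^ rounds) _) leftover))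
    where
      few : length pairs * E ^ rounds < D ^ rounds
      few = m<n∧n*o≤p∧0<p⇒m*o<p length-pairs<2^r 2^r*E^rounds≤D^rounds
                                (>-nonZero⁻¹ (D ^ rounds) {{m^n≢0 D rounds}})

  family-separating : Separating a b family
  family-separating A B ∣A∣≤a ∣B∣≤b A∩B=∅
    with uncovered≡[]⇒covered family uncovered≡[] (disjointPairs-complete A B ∣A∣≤a ∣B∣≤b A∩B=∅)
  ... | S , S∈family , separated = S , S∈family , separates⇒⊆ S A B separated , separates⇒⊆∁ S A B separated

  lg-length-family : lg (length family) ≤ 4 * (lg (lg u) + lg nCa)
  lg-length-family = begin
    lg (length family)                ≡⟨ cong lg length-family ⟩
    lg (suc n * nCa * (lg u * n))     ≤⟨ lg-* (suc n * nCa) (lg u * n) ⟩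
    lg (suc n * nCa) + lg (lg u * n)  ≤⟨ +-mono-≤ (lg-* (suc n) nCa) (lg-* (lg u) n) ⟩
    lg (suc n) + K + (M + lg n)       ≤⟨ +-mono-≤ (+-monoˡ-≤ K (≤-trans (lg-mono-≤ (s≤s n≤nCa)) (lg-suc nCa)))
                                                  (+-monoʳ-≤ M (lg-mono-≤ n≤nCa)) ⟩
    suc K + K + (M + K)               ≤⟨ +-monoˡ-≤ (M + K) (+-monoˡ-≤ K (+-monoˡ-≤ K (s≤s z≤n))) ⟩
    K + K + K + (M + K)               ≡⟨ solve 2 (λ M K → K :+ K :+ K :+ (M :+ K) := M :+ con 4 :* K) refl M K ⟩
    M + 4 * K                         ≤⟨ +-monoˡ-≤ (4 * K) (m≤n*m M 4) ⟩
    4 * M + 4 * K                     ≡⟨ sym (*-distribˡ-+ 4 M K) ⟩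
    4 * (M + K)                       ∎
    where
      open ≤-Reasoning
      M K : ℕ
      M = lg (lg u)
      K = lg nCa

lemma6p2 : Σ ℕ λ c → (a b u : ℕ) → a + b ≤ u →
    Σ (List (Subset u)) λ 𝕊 →
      (lg (length 𝕊) ≤ c * (lg (lg u) + lg ((a + b) C a)))
      × ((A B : Subset u) → ∣ A ∣ ≤ a → ∣ B ∣ ≤ b → Empty (A ∩ B) →
          Σ (Subset u) λ S → (S ∈ 𝕊) × (A ⊆ S) × (B ⊆ ∁ S))
lemma6p2 = 4 , λ where
  zero    b       u _ → [ ⊥ ] , lg1≤4*[lg+lg] (lg u) (b C 0) , [⊥]-separating b
  (suc a) zero    u _ → [ ⊤ ] , lg1≤4*[lg+lg] (lg u) ((suc a + 0) C suc a) , [⊤]-separating (suc a)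
  (suc a) (suc b) u _ → let open GreedyFamily (suc a) (suc b) u in family , lg-length-family , family-separating
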